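{- Let $G$ be a finite simple $2$-connected graph and let $v \in V(G)$ with $d(v) \geq 3$. Then $v$ is contained in a cycle of even length.
   Context: Graphs are finite, simple (no loops, no multiple edges). $d(v)$ denotes the degree of $v$. A graph is $2$-connected if it has more than $2$ vertices and remains connected whenever fewer than $2$ vertices are removed. The length of a cycle is its number of edges. -}

module Defs where

open import Data.Nat using (ℕ; _<_; _≤_; _*_)
open import Data.Bool using (Bool; true; false; T)
open import Data.Fin using (Fin)
open import Data.List using (List; []; _∷_; length; filter; head; last)
open import Data.List.Relation.Unary.All using (All)
open import Data.List.Relation.Unary.Unique.Propositional using (Unique)
open import Data.List.Membership.Propositional using (_∈_)
open import Data.Product using (_×_; Σ; ∃; ∃-syntax; _,_)
open import Data.Maybe using (Maybe; just; nothing)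
open import Relation.Binary.PropositionalEquality using (_≡_; _≢_)
open import Relation.Nullary using (¬_)
open import Data.List using (allFin)
open import Data.Bool using (_≟_)

record Graph (n : ℕ) : Set where
  field
    adj   : Fin n → Fin n → Bool
    sym   : ∀ u v → adj u v ≡ adj v u
    irrefl : ∀ v → adj v v ≡ false
open Graph public

Adj : ∀ {n} → Graph n → Fin n → Fin n → Set
Adj G u v = T (adj G u v)

degree : ∀ {n} → Graph n → Fin n → ℕ
degree {n} G v = length (filter (λ u → adj G v u ≟ true) (allFin n))

-- a walk: a list of vertices with consecutive vertices adjacent
data IsPath {n} (G : Graph n) : List (Fin n) → Set where
  single : ∀ v → IsPath G (v ∷ [])
  step   : ∀ u v vs → Adj G u v → IsPath G (v ∷ vs) → IsPath G (u ∷ v ∷ vs)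

WalkWithin : ∀ {n} → Graph n → (Fin n → Set) → Fin n → Fin n → Set
WalkWithin G P x y =
  ∃[ w ] (IsPath G w × head w ≡ just x × last w ≡ just y × All P w)

ConnectedAvoiding : ∀ {n} → Graph n → (Fin n → Set) → Set
ConnectedAvoiding {n} G X =
  ∀ x y → ¬ X x → ¬ X y → WalkWithin G (λ z → ¬ X z) x y

-- 2-connected: more than 2 vertices and removing any set of fewer than 2
-- vertices (i.e. the empty set or a single vertex) leaves a connected graph.
TwoConnected : ∀ {n} → Graph n → Set
TwoConnected {n} G =
  2 < n
  × ConnectedAvoiding G (λ _ → Data.Empty.⊥)
  × (∀ (a : Fin n) → ConnectedAvoiding G (λ z → z ≡ a))
  where import Data.Empty

IsCycle : ∀ {n} → Graph n → List (Fin n) → Set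
IsCycle G c =
  3 ≤ length c × Unique c × IsPath G c
  × ∃[ a ] ∃[ b ] (head c ≡ just a × last c ≡ just b × Adj G b a)

cycleLength : ∀ {n} → List (Fin n) → ℕ
cycleLength = length

Even : ℕ → Set
Even m = ∃[ k ] (m ≡ 2 * k)

-- Let a, b, c be neighbours of v and P, Q simple paths a–b and a–c in G − v, which exist
-- because G − v is connected. If P has even length, v a P b v is an even cycle. Otherwise let
-- w be the last vertex of Q on P and D the part of Q after w; w cuts P into A (a–w) and
-- B (w–b) of odd total length. Then v A D v and v B⁻¹ D v are cycles of lengths
-- |A| + |D| + 2 and |B| + |D| + 2, and as |A| + |B| is odd, one of them is even.
module Submission where

open import Defs hiding (sym)
open import Data.Nat using (ℕ; zero; suc; _+_; _*_; _≤_; s≤s; z≤n)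
open import Data.Nat.Properties using (+-suc; +-comm; suc-injective)
open import Data.Nat.Solver using (module +-*-Solver)
open import Data.Fin using (Fin; _≟_)
open import Data.Bool using (true; T)
import Data.Bool as Bool
open import Data.List using (List; []; _∷_; _∷ʳ_; length; reverse; filter; allFin; head; last)
open import Data.List.Properties using (unfold-reverse)
open import Data.List.Relation.Unary.Any using (here; there)
open import Data.List.Relation.Unary.Any.Properties using (reverse⁻)
open import Data.List.Relation.Unary.All as All using (All; []; _∷_)
open import Data.List.Relation.Unary.All.Properties using (All¬⇒¬Any; ¬Any⇒All¬)
open import Data.List.Relation.Unary.AllPairs using ([]; _∷_)
open import Data.List.Relation.Unary.Unique.Propositional using (Unique)
import Data.List.Relation.Unary.Unique.Propositional.Properties as Unique
open import Data.List.Membership.Propositional using (_∈_; _∉_)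
open import Data.List.Membership.Propositional.Properties using (∈-filter⁻)
import Data.List.Membership.DecPropositional as DecMembership
open import Data.List.Relation.Binary.Subset.Propositional using (_⊆_)
import Data.List.Relation.Binary.Permutation.Setoid as Permutation
import Data.List.Relation.Binary.Permutation.Setoid.Properties as PermutationProperties
open import Data.Maybe using (just)
open import Data.Product using (_×_; Σ; ∃-syntax; ∃₂; _,_; proj₁; proj₂)
open import Data.Sum using (_⊎_; inj₁; inj₂; [_,_]′)
open import Data.Empty using (⊥-elim)
open import Data.Unit using (tt)
open import Function using (_∘_)
open import Relation.Binary.PropositionalEquality
  using (_≡_; _≢_; refl; sym; trans; cong; subst; setoid; module ≡-Reasoning)
open import Relation.Nullary using (¬_; yes; no)
open import Relation.Unary using (Pred; Decidable)

Even-suc-suc : ∀ {m} → Even m → Even (suc (suc m))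
Even-suc-suc (k , refl) = suc k , cong suc (sym (+-suc k (k + 0)))

Even-suc-suc⁻ : ∀ {m} → Even (suc (suc m)) → Even m
Even-suc-suc⁻ (zero , ())
Even-suc-suc⁻ (suc k , eq) = k , suc-injective (trans (suc-injective eq) (+-suc k (k + 0)))

even⊎odd : ∀ m → Even m ⊎ Even (suc m)
even⊎odd zero = inj₁ (0 , refl)
even⊎odd (suc m) with even⊎odd m
... | inj₁ even = inj₂ (Even-suc-suc even)
... | inj₂ odd  = inj₁ odd

Even-+ : ∀ {m n} → Even m → Even n → Even (m + n)
Even-+ (k , refl) (l , refl) = k + l , double-+ k l
  where
  open +-*-Solver
  double-+ : ∀ k l → 2 * k + 2 * l ≡ 2 * (k + l)
  double-+ = solve 2 (λ k l → con 2 :* k :+ con 2 :* l := con 2 :* (k :+ l)) refl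

Even-+-cancelˡ : ∀ {m n} → Even m → Even (m + n) → Even n
Even-+-cancelˡ (zero , refl) even = even
Even-+-cancelˡ {n = n} (suc k , refl) even =
  Even-+-cancelˡ (k , refl) (Even-suc-suc⁻ (subst Even (double-suc k n) even))
  where
  open +-*-Solver
  double-suc : ∀ k n → 2 * suc k + n ≡ suc (suc (2 * k + n))
  double-suc = solve 2 (λ k n → con 2 :* (con 1 :+ k) :+ n := con 2 :+ (con 2 :* k :+ n)) refl

odd-sum⇒even-sum : ∀ {a b} d → Even (suc (a + b)) → Even (a + d) ⊎ Even (b + d)
odd-sum⇒even-sum {a} {b} d odd with even⊎odd (a + d)
... | inj₁ even = inj₁ even
... | inj₂ odd′ = inj₂ (Even-+-cancelˡ (suc a , refl)
  (subst Even (regroup a b d) (Even-+ odd odd′)))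
  where
  open +-*-Solver
  regroup : ∀ a b d → suc (a + b) + suc (a + d) ≡ 2 * suc a + (b + d)
  regroup = solve 3 (λ a b d → (con 1 :+ (a :+ b)) :+ (con 1 :+ (a :+ d))
                             := con 2 :* (con 1 :+ a) :+ (b :+ d)) refl

three-distinct : ∀ {A : Set} {xs : List A} → 3 ≤ length xs → Unique xs →
  ∃[ a ] ∃[ b ] ∃[ c ] (a ∈ xs × b ∈ xs × c ∈ xs × a ≢ b × a ≢ c × b ≢ c)
three-distinct {xs = a ∷ b ∷ c ∷ _} _ ((a≢b ∷ a≢c ∷ _) ∷ (b≢c ∷ _) ∷ _) =
  a , b , c , here refl , there (here refl) , there (there (here refl)) , a≢b , a≢c , b≢c
three-distinct {xs = []} () _
three-distinct {xs = _ ∷ []} (s≤s ()) _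
three-distinct {xs = _ ∷ _ ∷ []} (s≤s (s≤s ())) _

EvenCycleThrough : ∀ {n} → Graph n → Fin n → Set
EvenCycleThrough G v = ∃[ c ] (IsCycle G c × v ∈ c × Even (cycleLength c))

infixr 5 _∷⟨_⟩_

data Walk {n} (G : Graph n) : Fin n → Fin n → Set where
  [_]    : ∀ x → Walk G x x
  _∷⟨_⟩_ : ∀ x {y z} → Adj G x y → Walk G y z → Walk G x z

module _ {n : ℕ} {G : Graph n} where

  open DecMembership (_≟_ {n}) using (_∈?_)

  infixr 5 _++ʷ_
  infixl 5 _∷ʳ⟨_⟩

  private
    variable
      x y z w : Fin n

  vertices : Walk G x y → List (Fin n)
  vertices [ x ] = x ∷ []
  vertices (x ∷⟨ _ ⟩ p) = x ∷ vertices p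

  lengthʷ : Walk G x y → ℕ
  lengthʷ [ _ ] = 0
  lengthʷ (_ ∷⟨ _ ⟩ p) = suc (lengthʷ p)

  Simple : Walk G x y → Set
  Simple p = Unique (vertices p)

  Adj-sym : Adj G x y → Adj G y x
  Adj-sym {x} {y} = subst T (Graph.sym G x y)

  Adj⇒≢ : Adj G x y → x ≢ y
  Adj⇒≢ {x} e refl = subst T (irrefl G x) e

  _++ʷ_ : Walk G x y → Walk G y z → Walk G x z
  [ _ ] ++ʷ q = q
  (x ∷⟨ e ⟩ p) ++ʷ q = x ∷⟨ e ⟩ (p ++ʷ q)

  _∷ʳ⟨_⟩ : Walk G x y → Adj G y z → Walk G x z
  p ∷ʳ⟨ e ⟩ = p ++ʷ _ ∷⟨ e ⟩ [ _ ]

  reverseʷ : Walk G x y → Walk G y x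
  reverseʷ [ x ] = [ x ]
  reverseʷ (x ∷⟨ e ⟩ p) = reverseʷ p ∷ʳ⟨ Adj-sym e ⟩

  head∈vertices : (p : Walk G x y) → x ∈ vertices p
  head∈vertices [ x ] = here refl
  head∈vertices (x ∷⟨ _ ⟩ p) = here refl

  last∈vertices : (p : Walk G x y) → y ∈ vertices p
  last∈vertices [ x ] = here refl
  last∈vertices (x ∷⟨ _ ⟩ p) = there (last∈vertices p)

  length-vertices : (p : Walk G x y) → length (vertices p) ≡ suc (lengthʷ p)
  length-vertices [ x ] = refl
  length-vertices (x ∷⟨ _ ⟩ p) = cong suc (length-vertices p)

  length-++ʷ : (p : Walk G x y) (q : Walk G y z) → lengthʷ (p ++ʷ q) ≡ lengthʷ p + lengthʷ q
  length-++ʷ [ x ] q = refl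
  length-++ʷ (x ∷⟨ _ ⟩ p) q = cong suc (length-++ʷ p q)

  length-reverseʷ : (p : Walk G x y) → lengthʷ (reverseʷ p) ≡ lengthʷ p
  length-reverseʷ [ x ] = refl
  length-reverseʷ (x ∷⟨ e ⟩ p) = begin
    lengthʷ (reverseʷ p ∷ʳ⟨ Adj-sym e ⟩) ≡⟨ length-++ʷ (reverseʷ p) _ ⟩
    lengthʷ (reverseʷ p) + 1             ≡⟨ +-comm (lengthʷ (reverseʷ p)) 1 ⟩
    suc (lengthʷ (reverseʷ p))           ≡⟨ cong suc (length-reverseʷ p) ⟩
    suc (lengthʷ p)                      ∎
    where open ≡-Reasoning

  vertices-∷ʳ : (p : Walk G x y) (e : Adj G y z) → vertices (p ∷ʳ⟨ e ⟩) ≡ vertices p ∷ʳ z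
  vertices-∷ʳ [ x ] e = refl
  vertices-∷ʳ (x ∷⟨ _ ⟩ p) e = cong (x ∷_) (vertices-∷ʳ p e)

  vertices-reverseʷ : (p : Walk G x y) → vertices (reverseʷ p) ≡ reverse (vertices p)
  vertices-reverseʷ [ x ] = refl
  vertices-reverseʷ (x ∷⟨ e ⟩ p) = begin
    vertices (reverseʷ p ∷ʳ⟨ Adj-sym e ⟩) ≡⟨ vertices-∷ʳ (reverseʷ p) (Adj-sym e) ⟩
    vertices (reverseʷ p) ∷ʳ x            ≡⟨ cong (_∷ʳ x) (vertices-reverseʷ p) ⟩
    reverse (vertices p) ∷ʳ x             ≡⟨ unfold-reverse x (vertices p) ⟨
    reverse (x ∷ vertices p)              ∎
    where open ≡-Reasoning

  ∈-reverseʷ⁻ : (p : Walk G x y) → vertices (reverseʷ p) ⊆ vertices p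
  ∈-reverseʷ⁻ p z∈ = reverse⁻ (subst (_ ∈_) (vertices-reverseʷ p) z∈)

  simple-reverseʷ : (p : Walk G x y) → Simple p → Simple (reverseʷ p)
  simple-reverseʷ p simple = subst Unique (sym (vertices-reverseʷ p))
    (Unique-resp-↭ (↭-sym (↭-reverse (vertices p))) simple)
    where
    open Permutation (setoid (Fin n)) using (↭-sym)
    open PermutationProperties (setoid (Fin n)) using (Unique-resp-↭; ↭-reverse)

  ∈-++ʷ⁺ˡ : (p : Walk G x y) (q : Walk G y z) → vertices p ⊆ vertices (p ++ʷ q)
  ∈-++ʷ⁺ˡ [ x ] q (here refl) = head∈vertices q
  ∈-++ʷ⁺ˡ (x ∷⟨ _ ⟩ p) q (here refl) = here refl
  ∈-++ʷ⁺ˡ (x ∷⟨ _ ⟩ p) q (there z∈) = there (∈-++ʷ⁺ˡ p q z∈)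

  ∈-++ʷ⁺ʳ : (p : Walk G x y) (q : Walk G y z) → vertices q ⊆ vertices (p ++ʷ q)
  ∈-++ʷ⁺ʳ [ x ] q z∈ = z∈
  ∈-++ʷ⁺ʳ (x ∷⟨ _ ⟩ p) q z∈ = there (∈-++ʷ⁺ʳ p q z∈)

  ∈-++ʷ⁻ : (p : Walk G x y) (q : Walk G y z) →
           ∀ {v} → v ∈ vertices (p ++ʷ q) → v ∈ vertices p ⊎ v ∈ vertices q
  ∈-++ʷ⁻ [ x ] q v∈ = inj₂ v∈
  ∈-++ʷ⁻ (x ∷⟨ _ ⟩ p) q (here refl) = inj₁ (here refl)
  ∈-++ʷ⁻ (x ∷⟨ _ ⟩ p) q (there v∈) with ∈-++ʷ⁻ p q v∈
  ... | inj₁ v∈p = inj₁ (there v∈p)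
  ... | inj₂ v∈q = inj₂ v∈q

  simple-++ʷ⁻ : (p : Walk G x y) (q : Walk G y z) → Simple (p ++ʷ q) → Simple p × Simple q
  simple-++ʷ⁻ [ x ] q simple = ([] ∷ []) , simple
  simple-++ʷ⁻ (x ∷⟨ _ ⟩ p) q (x∉ ∷ simple) =
    (All.tabulate (All.lookup x∉ ∘ ∈-++ʷ⁺ˡ p q) ∷ proj₁ (simple-++ʷ⁻ p q simple)) ,
    proj₂ (simple-++ʷ⁻ p q simple)

  simple-++ʷ⁺ : (p : Walk G x y) (q : Walk G y z) → Simple p → Simple q →
                (∀ {v} → v ∈ vertices p → v ∈ vertices q → v ≡ y) → Simple (p ++ʷ q)
  simple-++ʷ⁺ [ x ] q _ simple-q _ = simple-q
  simple-++ʷ⁺ (x ∷⟨ _ ⟩ p) q (x∉p ∷ simple-p) simple-q meet =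
    All.tabulate x∉ ∷ simple-++ʷ⁺ p q simple-p simple-q (meet ∘ there)
    where
    x∉ : ∀ {v} → v ∈ vertices (p ++ʷ q) → x ≢ v
    x∉ v∈ with ∈-++ʷ⁻ p q v∈
    ... | inj₁ v∈p = All.lookup x∉p v∈p
    ... | inj₂ v∈q = λ { refl → All.lookup x∉p (last∈vertices p) (meet (here refl) v∈q) }

  splitAt : (p : Walk G x y) → w ∈ vertices p → ∃₂ λ (q : Walk G x w) (r : Walk G w y) → q ++ʷ r ≡ p
  splitAt [ x ] (here refl) = [ x ] , [ x ] , refl
  splitAt (x ∷⟨ e ⟩ p) (here refl) = [ x ] , x ∷⟨ e ⟩ p , refl
  splitAt (x ∷⟨ e ⟩ p) (there w∈) with splitAt p w∈
  ... | q , r , refl = x ∷⟨ e ⟩ q , r , refl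

  simplify : (p : Walk G x y) → Σ (Walk G x y) λ q → Simple q × vertices q ⊆ vertices p
  simplify [ x ] = [ x ] , ([] ∷ []) , λ z∈ → z∈
  simplify (x ∷⟨ e ⟩ p) with simplify p
  ... | q , simple , q⊆p with x ∈? vertices q
  ...   | no x∉q = x ∷⟨ e ⟩ q , ¬Any⇒All¬ (vertices q) x∉q ∷ simple , λ
            { (here refl) → here refl ; (there z∈) → there (q⊆p z∈) }
  ...   | yes x∈q with splitAt q x∈q
  ...     | q₁ , q₂ , refl = q₂ , proj₂ (simple-++ʷ⁻ q₁ q₂ simple) , there ∘ q⊆p ∘ ∈-++ʷ⁺ʳ q₁ q₂

  lastVisit : ∀ {ℓ} {P : Pred (Fin n) ℓ} → Decidable P → (p : Walk G x y) →
              (∀ {v} → v ∈ vertices p → ¬ P v)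
              ⊎ ∃[ w ] (P w × ∃₂ λ (q : Walk G x w) (r : Walk G w y) →
                          q ++ʷ r ≡ p × (∀ {v} → v ∈ vertices r → P v → v ≡ w))
  lastVisit P? [ x ] with P? x
  ... | yes Px = inj₂ (x , Px , [ x ] , [ x ] , refl , λ { (here refl) _ → refl })
  ... | no ¬Px = inj₁ λ { (here refl) → ¬Px }
  lastVisit P? (x ∷⟨ e ⟩ p) with lastVisit P? p
  ... | inj₂ (w , Pw , q , r , refl , after) = inj₂ (w , Pw , x ∷⟨ e ⟩ q , r , refl , after)
  ... | inj₁ p-avoids with P? x
  ...   | yes Px = inj₂ (x , Px , [ x ] , x ∷⟨ e ⟩ p , refl , λ
            { (here refl) _ → refl ; (there v∈) Pv → ⊥-elim (p-avoids v∈ Pv) })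
  ...   | no ¬Px = inj₁ λ { (here refl) → ¬Px ; (there v∈) → p-avoids v∈ }

  IsPath-vertices : (p : Walk G x y) → IsPath G (vertices p)
  IsPath-vertices [ x ] = single x
  IsPath-vertices (x ∷⟨ e ⟩ [ y ]) = step x y [] e (single y)
  IsPath-vertices (x ∷⟨ e ⟩ p@(y ∷⟨ _ ⟩ q)) = step x y (vertices q) e (IsPath-vertices p)

  last-vertices : (p : Walk G x y) → last (vertices p) ≡ just y
  last-vertices [ x ] = refl
  last-vertices (x ∷⟨ e ⟩ [ y ]) = refl
  last-vertices (x ∷⟨ e ⟩ p@(y ∷⟨ _ ⟩ q)) = last-vertices p

  IsPath⇒Walk : ∀ {vs} → IsPath G vs → head vs ≡ just x → last vs ≡ just y →
                Σ (Walk G x y) λ p → vertices p ≡ vs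
  IsPath⇒Walk (single v) refl refl = [ v ] , refl
  IsPath⇒Walk (step u v vs e path) refl last≡ with IsPath⇒Walk path refl last≡
  ... | p , vertices≡ = u ∷⟨ e ⟩ p , cong (u ∷_) vertices≡

  simpleWalkWithin : ∀ {P : Fin n → Set} → WalkWithin G P x y →
                     Σ (Walk G x y) λ p → Simple p × All P (vertices p)
  simpleWalkWithin (vs , path , head≡ , last≡ , all) with IsPath⇒Walk path head≡ last≡
  ... | p , refl with simplify p
  ...   | q , simple , q⊆p = q , simple , All.tabulate (All.lookup all ∘ q⊆p)

  IsCycle-closing : ∀ {v a c} (va : Adj G v a) (p : Walk G a c) → Adj G c v → a ≢ c →
                       Simple p → v ∉ vertices p → IsCycle G (vertices (v ∷⟨ va ⟩ p))
  IsCycle-closing va [ a ] cv a≢c = ⊥-elim (a≢c refl)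
  IsCycle-closing {v} {c = c} va p@(a ∷⟨ _ ⟩ q) cv _ simple v∉p =
    s≤s (s≤s (subst (1 ≤_) (sym (length-vertices q)) (s≤s z≤n))) ,
    ¬Any⇒All¬ (vertices p) v∉p ∷ simple ,
    IsPath-vertices (v ∷⟨ va ⟩ p) ,
    v , c , refl , last-vertices (v ∷⟨ va ⟩ p) , cv

  evenCycle : ∀ {v a c} (va : Adj G v a) (p : Walk G a c) → Adj G c v → a ≢ c →
              Simple p → v ∉ vertices p → Even (lengthʷ p) → EvenCycleThrough G v
  evenCycle va p cv a≢c simple v∉p even =
    vertices (_ ∷⟨ va ⟩ p) , IsCycle-closing va p cv a≢c simple v∉p , here refl ,
    subst (Even ∘ suc) (sym (length-vertices p)) (Even-suc-suc even)

  three-neighbours : ∀ {v} → 3 ≤ degree G v →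
    ∃[ a ] ∃[ b ] ∃[ c ] (Adj G v a × Adj G v b × Adj G v c × a ≢ b × a ≢ c × b ≢ c)
  three-neighbours {v} deg =
    let a , b , c , a∈ , b∈ , c∈ , distinct =
          three-distinct deg (Unique.filter⁺ adjacent? (Unique.allFin⁺ n))
    in a , b , c , neighbour a∈ , neighbour b∈ , neighbour c∈ , distinct
    where
    adjacent? : Decidable (λ u → adj G v u ≡ true)
    adjacent? u = adj G v u Bool.≟ true
    neighbour : ∀ {u} → u ∈ filter adjacent? (allFin n) → Adj G v u
    neighbour u∈ = subst T (sym (proj₂ (∈-filter⁻ adjacent? {xs = allFin n} u∈))) tt

  evenCycle-splitPath : ∀ {v a b c w} (A : Walk G a w) (B : Walk G w b) (D : Walk G w c) →
    Adj G v a → Adj G v b → Adj G v c → a ≢ c → b ≢ c →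
    Simple (A ++ʷ B) → v ∉ vertices (A ++ʷ B) → Simple D → v ∉ vertices D →
    (∀ {u} → u ∈ vertices D → u ∈ vertices (A ++ʷ B) → u ≡ w) →
    Even (suc (lengthʷ A + lengthʷ B)) → EvenCycleThrough G v
  evenCycle-splitPath {v} {c = c} {w} A B D va vb vc a≢c b≢c simple-AB v∉AB simple-D v∉D D-leaves-AB odd =
    [ via A va a≢c (proj₁ (simple-++ʷ⁻ A B simple-AB)) (∈-++ʷ⁺ˡ A B)
    , via (reverseʷ B) vb b≢c (simple-reverseʷ B (proj₂ (simple-++ʷ⁻ A B simple-AB)))
          (∈-++ʷ⁺ʳ A B ∘ ∈-reverseʷ⁻ B)
      ∘ subst (λ k → Even (k + lengthʷ D)) (sym (length-reverseʷ B))
    ]′ (odd-sum⇒even-sum (lengthʷ D) odd)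
    where
    via : ∀ {s} (X : Walk G s w) → Adj G v s → s ≢ c → Simple X → vertices X ⊆ vertices (A ++ʷ B) →
          Even (lengthʷ X + lengthʷ D) → EvenCycleThrough G v
    via X vs s≢c simple-X X⊆AB even = evenCycle vs (X ++ʷ D) (Adj-sym vc) s≢c
      (simple-++ʷ⁺ X D simple-X simple-D (λ u∈X u∈D → D-leaves-AB u∈D (X⊆AB u∈X)))
      (λ v∈ → [ v∉AB ∘ X⊆AB , v∉D ]′ (∈-++ʷ⁻ X D v∈))
      (subst Even (sym (length-++ʷ X D)) even)

  evenCycle-fromPaths : ∀ {v a b c} → Adj G v a → Adj G v b → Adj G v c → a ≢ b → a ≢ c → b ≢ c →
    (P : Walk G a b) → Simple P → v ∉ vertices P →
    (Q : Walk G a c) → Simple Q → v ∉ vertices Q → EvenCycleThrough G v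
  evenCycle-fromPaths va vb vc a≢b a≢c b≢c P simple-P v∉P Q simple-Q v∉Q
    with even⊎odd (lengthʷ P) | lastVisit (_∈? vertices P) Q
  ... | inj₁ even | _ = evenCycle va P (Adj-sym vb) a≢b simple-P v∉P even
  ... | inj₂ _    | inj₁ Q-avoids-P = ⊥-elim (Q-avoids-P (head∈vertices Q) (head∈vertices P))
  ... | inj₂ odd  | inj₂ (w , w∈P , C , D , refl , D-leaves-P) with splitAt P w∈P
  ...   | A , B , refl =
    evenCycle-splitPath A B D va vb vc a≢c b≢c simple-P v∉P
      (proj₂ (simple-++ʷ⁻ C D simple-Q)) (v∉Q ∘ ∈-++ʷ⁺ʳ C D) D-leaves-P
      (subst (Even ∘ suc) (length-++ʷ A B) odd)

theorem4 : ∀ (n : ℕ) (G : Graph n) (v : Fin n) →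
    TwoConnected G → 3 ≤ degree G v →
    ∃[ c ] (IsCycle G c × v ∈ c × Even (cycleLength c))
theorem4 n G v (_ , _ , connected-without) deg =
  let a , b , c , va , vb , vc , a≢b , a≢c , b≢c = three-neighbours {G = G} deg
      P , simple-P , P-avoids-v = simpleWalkWithin (connected-without v a b (≢v va) (≢v vb))
      Q , simple-Q , Q-avoids-v = simpleWalkWithin (connected-without v a c (≢v va) (≢v vc))
  in evenCycle-fromPaths va vb vc a≢b a≢c b≢c
       P simple-P (avoids P-avoids-v) Q simple-Q (avoids Q-avoids-v)
  where
  ≢v : ∀ {u} → Adj G v u → u ≢ v
  ≢v vu = Adj⇒≢ {G = G} vu ∘ sym
  avoids : ∀ {xs} → All (λ z → ¬ z ≡ v) xs → v ∉ xs
  avoids = All¬⇒¬Any ∘ All.map (_∘ sym)
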